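{- Let $x,y,z$ be non-empty strings over a finite alphabet $\Sigma$, let $s$ be a string having $xyz$ as a substring, and let $p$ be a positive integer. If $p$ is a parameterized period of $xy$, $p$ is a parameterized period of $yz$, and $|y| \ge p\cdot(|\Sigma_s|-1)+1$, then $p$ is a parameterized period of $xyz$.
   Context: For a string $w$, $\Sigma_w$ denotes the set of distinct characters occurring in $w$. Two strings $u,v$ of equal length $k$ are parameterized equivalent, written $u\approx v$, if there is a bijection $f:\Sigma\to\Sigma$ with $f(u[i])=v[i]$ for all $1\le i\le k$. A positive integer $p$ is a parameterized period of a string $w$ if $w[1..|w|-p] \approx w[p+1..|w|]$, i.e., there is a bijection $f$ of $\Sigma$ with $f(w[i]) = w[i+p]$ for all $1 \le i \le |w|-p$. -}

module Defs where

open import Data.Nat using (ℕ; _∸_)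
open import Data.Fin using (Fin)
open import Data.Fin.Properties using (_≟_)
open import Data.List using (List; length; take; drop; map; _++_; deduplicate)
open import Data.Product using (Σ; ∃; _×_)
open import Function.Definitions using (Bijective)
open import Relation.Binary.PropositionalEquality using (_≡_)

Str : ℕ → Set
Str k = List (Fin k)

-- u ≈ v : parameterized equivalence (for equal-length strings; map f u ≡ v forces equal length).
_≈ₚ_ : ∀ {k} → Str k → Str k → Set
_≈ₚ_ {k} u v = Σ (Fin k → Fin k) λ f → Bijective _≡_ _≡_ f × (map f u ≡ v)

-- p is a parameterized period of w : w[1..|w|-p] ≈ w[p+1..|w|]
-- (positivity of p is imposed separately in the statement).
IsPPeriod : ∀ {k} → Str k → ℕ → Set
IsPPeriod w p = take (length w ∸ p) w ≈ₚ drop p w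

numChars : ∀ {k} → Str k → ℕ
numChars s = length (deduplicate _≟_ s)

IsSubstring : ∀ {k} → Str k → Str k → Set
IsSubstring w s = ∃ λ u → ∃ λ v → s ≡ u ++ w ++ v

-- A p-period of w amounts to p-coherence: for positions i, j with i + p and j + p inside w,
-- w[i] = w[j] iff w[i+p] = w[j+p]. The pairs (w[i], w[i+p]) then form a partial bijection,
-- which transpositions extend to a permutation of the alphabet.
-- The periods of xy and yz give coherence for all pairs except those with i in x and j + p in z
-- (or vice versa).
-- Call the window the set of characters at positions of y whose shift by p is still in y.
-- If w[i] or w[j] is in the window, coherence transfers through that occurrence. Otherwise
-- w[i] = w[j], since a character c outside the window that occurs in x is the only character
-- of s outside the window. Indeed, with σ = |Σ_s| and a = |x|, the σ - 1 window characters
-- w[a], w[a+p], …, w[a+(σ-2)p] (this is where |y| ≥ p(σ-1)+1 is used), c and another outsider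
-- d ≠ c are σ + 1 characters of s, so two window ones coincide and the shift w[t] ↦ w[t+p] has
-- a cycle inside the window. Counting again with that cycle, c, d and σ - 2 window positions on
-- the orbit of an occurrence of c in x puts this orbit on a cycle in the window, and following
-- the cycle backwards (the shift is injective) puts c itself in the window.
-- The mirror image of the argument, on yz read backwards, gives w[i+p] = w[j+p].
module Submission where

open import Data.Empty using (⊥; ⊥-elim)
open import Data.Fin as Fin using (Fin; zero; suc; toℕ)
import Data.Fin.Permutation.Components as PC
open import Data.Fin.Permutation as Permutation
  using (Permutation′; _⟨$⟩ʳ_; _∘ₚ_; transpose)
import Data.Fin.Properties as Finₚ
open import Data.List using (List; []; _∷_; length; _++_; map; take; drop; zip; lookup; deduplicate)
open import Data.List.Membership.Propositional using (_∈_)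
open import Data.List.Membership.Propositional.Properties using (∈-map⁺; ∈-deduplicate⁺; ∈-++⁺ˡ; ∈-++⁺ʳ)
open import Data.List.Properties using (length-take; length-drop; length-++; length-map; ++-assoc)
open import Data.List.Relation.Unary.All as All using (All; []; _∷_)
open import Data.List.Relation.Unary.Any using (here; there; index)
open import Data.List.Relation.Unary.Any.Properties using (lookup-index)
open import Data.Maybe as Maybe using (Maybe; just; nothing)
open import Data.Maybe.Properties using (just-injective; map-injective; ≡-dec)
open import Data.Nat using (ℕ; zero; suc; _+_; _*_; _∸_; _≤_; _<_; s≤s; z≤n; _≤?_; _<?_)
open import Data.Nat.Properties
  using ( +-assoc; +-comm; +-identityʳ; +-suc; *-comm; *-distribʳ-+; suc-injective
        ; ≤-refl; ≤-reflexive; ≤-trans; <-trans; ≤-<-trans; <-≤-trans; <⇒≤; ≰⇒>; ≮⇒≥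
        ; m≤m+n; m≤n+m; m+n≤o⇒m≤o; m≤n⇒∃[o]m+o≡n
        ; +-monoˡ-≤; +-monoʳ-≤; +-monoˡ-<; +-monoʳ-<; +-mono-<; *-monoˡ-≤
        ; +-cancelˡ-≤; +-cancelʳ-≤; +-cancelˡ-<
        ; m∸n≤m; ∸-+-assoc; m∸n+n≡m; m+n≤o⇒m≤o∸n; ∸-monoʳ-<; m∸[m∸n]≡n; m+n∸n≡m
        ; [m+n]∸[m+o]≡n∸o; m≤n⇒m⊓n≡m; anyUpTo? )
open import Data.Product using (∃; ∃₂; _×_; _,_; proj₁)
open import Data.Sum as Sum using (_⊎_; inj₁; inj₂; [_,_]′)
open import Data.Vec.Functional using () renaming (_∷_ to _∷ᶠ_)
open import Defs
open import Function using (_∘_; id)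
open import Function.Bundles using (_⇔_; mk⇔; Equivalence; Bijection)
open import Function.Definitions using (Injective; Bijective)
open import Function.Properties.Equivalence using () renaming (sym to ⇔-sym)
open import Function.Properties.Inverse using (Inverse⇒Bijection)
open import Relation.Binary.Definitions using (DecidableEquality)
open import Relation.Binary.PropositionalEquality
open import Relation.Nullary using (¬_; Dec; yes; no; contradiction)
open import Relation.Nullary.Decidable using (map′; _×-dec_; dec-true; dec-false)

open Equivalence using (to; from)

private
  variable
    A B : Set

at : List A → ℕ → Maybe A
at []       _       = nothing
at (x ∷ xs) zero    = just x
at (x ∷ xs) (suc i) = at xs i

at-++ˡ : ∀ (xs : List A) {ys i} → i < length xs → at (xs ++ ys) i ≡ at xs i
at-++ˡ (x ∷ xs) {i = zero}  _        = refl
at-++ˡ (x ∷ xs) {i = suc i} (s≤s i<) = at-++ˡ xs i<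

at-++ʳ : ∀ (xs : List A) {ys} i → at (xs ++ ys) (length xs + i) ≡ at ys i
at-++ʳ []       i = refl
at-++ʳ (x ∷ xs) i = at-++ʳ xs i

at-drop : ∀ p (xs : List A) i → at (drop p xs) i ≡ at xs (i + p)
at-drop zero    xs       i = cong (at xs) (sym (+-identityʳ i))
at-drop (suc p) []       i = refl
at-drop (suc p) (x ∷ xs) i = trans (at-drop p xs i) (cong (at (x ∷ xs)) (sym (+-suc i p)))

at-map : ∀ (f : A → B) xs i → at (map f xs) i ≡ Maybe.map f (at xs i)
at-map f []       i       = refl
at-map f (x ∷ xs) zero    = refl
at-map f (x ∷ xs) (suc i) = at-map f xs i

at-take : ∀ {q} (xs : List A) {i} → i < q → at (take q xs) i ≡ at xs i
at-take {q = suc q} []       _        = refl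
at-take {q = suc q} (x ∷ xs) {zero}  _        = refl
at-take {q = suc q} (x ∷ xs) {suc i} (s≤s i<) = at-take xs i<

at-take-just : ∀ q (xs : List A) {i x} → at (take q xs) i ≡ just x → at xs i ≡ just x
at-take-just (suc q) (y ∷ xs) {zero}  e = e
at-take-just (suc q) (y ∷ xs) {suc i} e = at-take-just q xs e

at-just⇒< : ∀ (xs : List A) {i x} → at xs i ≡ just x → i < length xs
at-just⇒< (y ∷ xs) {zero}  _ = s≤s z≤n
at-just⇒< (y ∷ xs) {suc i} e = s≤s (at-just⇒< xs e)

<⇒at-just : ∀ (xs : List A) {i} → i < length xs → ∃ λ x → at xs i ≡ just x × x ∈ xs
<⇒at-just (x ∷ xs) {zero}  _        = x , refl , here refl
<⇒at-just (x ∷ xs) {suc i} (s≤s i<) with y , e , y∈ ← <⇒at-just xs i< = y , e , there y∈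

∈-zip⇒at : ∀ {xs : List A} {ys : List B} {x y} → (x , y) ∈ zip xs ys →
           ∃ λ i → at xs i ≡ just x × at ys i ≡ just y
∈-zip⇒at {xs = _ ∷ _} {_ ∷ _} (here refl) = zero , refl , refl
∈-zip⇒at {xs = _ ∷ _} {_ ∷ _} (there q) with i , e , e′ ← ∈-zip⇒at q = suc i , e , e′

All-zip⇒map : ∀ {f : A → B} {xs ys} → length xs ≡ length ys →
              All (λ (x , y) → f x ≡ y) (zip xs ys) → map f xs ≡ ys
All-zip⇒map {xs = []}     {[]}     _   []           = refl
All-zip⇒map {xs = x ∷ xs} {y ∷ ys} len (fx≡y ∷ rest) =
  cong₂ _∷_ fx≡y (All-zip⇒map (suc-injective len) rest)

transpose-sends : ∀ {n} (i j : Fin n) → PC.transpose i j i ≡ j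
transpose-sends i j rewrite dec-true (i Finₚ.≟ i) refl = refl

transpose-fixes : ∀ {n} {i j k : Fin n} → k ≢ i → k ≢ j → PC.transpose i j k ≡ k
transpose-fixes {i = i} {j} {k} k≢i k≢j
  rewrite dec-false (k Finₚ.≟ i) k≢i | dec-false (k Finₚ.≟ j) k≢j = refl

permutation-bijective : ∀ {k} (π : Permutation′ k) → Bijective _≡_ _≡_ (π ⟨$⟩ʳ_)
permutation-bijective π = Bijection.bijective (Inverse⇒Bijection π)

PartialBijection : List (A × B) → Set
PartialBijection ps = ∀ {x y x′ y′} → (x , y) ∈ ps → (x′ , y′) ∈ ps → x ≡ x′ ⇔ y ≡ y′

Sends : ∀ {k} → Permutation′ k → List (Fin k × Fin k) → Set
Sends π ps = All (λ (x , y) → π ⟨$⟩ʳ x ≡ y) ps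

partialBijection⇒permutation : ∀ {k} (ps : List (Fin k × Fin k)) → PartialBijection ps →
                               ∃ λ π → Sends π ps
partialBijection⇒permutation []             _  = Permutation.id , []
partialBijection⇒permutation ((x , y) ∷ ps) pb
  with π , sends ← partialBijection⇒permutation ps (λ q q′ → pb (there q) (there q′))
  with π ⟨$⟩ʳ x Finₚ.≟ y
... | yes πx≡y = π , πx≡y ∷ sends
... | no  πx≢y = π ∘ₚ transpose (π ⟨$⟩ʳ x) y , transpose-sends (π ⟨$⟩ʳ x) y ∷ All.tabulate fixed
  where
  fixed : ∀ {(x′ , y′) : _ × _} → (x′ , y′) ∈ ps → PC.transpose (π ⟨$⟩ʳ x) y (π ⟨$⟩ʳ x′) ≡ y′
  fixed {x′ , y′} q rewrite All.lookup sends q = transpose-fixes y′≢πx y′≢y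
    where
    x′≢x : x′ ≢ x
    x′≢x refl = πx≢y (trans (All.lookup sends q) (to (pb (there q) (here refl)) refl))
    y′≢y : y′ ≢ y
    y′≢y = x′≢x ∘ from (pb (there q) (here refl))
    y′≢πx : y′ ≢ π ⟨$⟩ʳ x
    y′≢πx y′≡πx = x′≢x (proj₁ (permutation-bijective π) (trans (All.lookup sends q) y′≡πx))

Coherent : (ℕ → A) → ℕ → ℕ → ℕ → Set
Coherent v p i j = v i ≡ v j ⇔ v (i + p) ≡ v (j + p)

CoherentUpTo : (ℕ → A) → ℕ → ℕ → Set
CoherentUpTo v p n = ∀ {i j} → i + p < n → j + p < n → Coherent v p i j

shift⇒coherentUpTo : ∀ {v : ℕ → A} {p n} {f : A → A} → Injective _≡_ _≡_ f →
                     (∀ {i} → i + p < n → v (i + p) ≡ f (v i)) → CoherentUpTo v p n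
shift⇒coherentUpTo {f = f} f-inj shift {i} {j} hi hj = mk⇔
  (λ e → trans (shift hi) (trans (cong f e) (sym (shift hj))))
  (λ e → f-inj (trans (sym (shift hi)) (trans e (shift hj))))

period⇒coherentUpTo : ∀ {k} (w : Str k) p → IsPPeriod w p → CoherentUpTo (at w) p (length w)
period⇒coherentUpTo w p (f , (f-inj , _) , fw≡w) = shift⇒coherentUpTo (map-injective f-inj) shift
  where
  shift : ∀ {i} → i + p < length w → at w (i + p) ≡ Maybe.map f (at w i)
  shift {i} i+p<n = begin
    at w (i + p)                                ≡⟨ at-drop p w i ⟨
    at (drop p w) i                             ≡⟨ cong (λ u → at u i) fw≡w ⟨
    at (map f (take (length w ∸ p) w)) i        ≡⟨ at-map f (take (length w ∸ p) w) i ⟩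
    Maybe.map f (at (take (length w ∸ p) w) i)  ≡⟨ cong (Maybe.map f) (at-take w (m+n≤o⇒m≤o∸n (suc i) i+p<n)) ⟩
    Maybe.map f (at w i)                        ∎
    where open ≡-Reasoning

⇔-just : ∀ {a b c d : Maybe A} {x x′ y y′} → a ≡ just x → b ≡ just x′ → c ≡ just y → d ≡ just y′ →
         (a ≡ b ⇔ c ≡ d) → (x ≡ x′ ⇔ y ≡ y′)
⇔-just refl refl refl refl e = mk⇔ (just-injective ∘ to e ∘ cong just) (just-injective ∘ from e ∘ cong just)

shiftPairs : List A → ℕ → List (A × A)
shiftPairs w p = zip (take (length w ∸ p) w) (drop p w)

shiftPairs-positions : ∀ (w : List A) p {x y} → (x , y) ∈ shiftPairs w p →
                       ∃ λ i → i + p < length w × at w i ≡ just x × at w (i + p) ≡ just y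
shiftPairs-positions w p q with i , e , e′ ← ∈-zip⇒at q =
  i , at-just⇒< w y-at , at-take-just (length w ∸ p) w e , y-at
  where y-at = trans (sym (at-drop p w i)) e′

coherentUpTo⇒partialBijection : ∀ (w : List A) p → CoherentUpTo (at w) p (length w) →
                                PartialBijection (shiftPairs w p)
coherentUpTo⇒partialBijection w p coh q q′
  with i , hi , ex , ey ← shiftPairs-positions w p q
     | j , hj , ex′ , ey′ ← shiftPairs-positions w p q′ = ⇔-just ex ex′ ey ey′ (coh hi hj)

coherentUpTo⇒period : ∀ {k} (w : Str k) p → CoherentUpTo (at w) p (length w) → IsPPeriod w p
coherentUpTo⇒period w p coh
  with π , sends ← partialBijection⇒permutation (shiftPairs w p) (coherentUpTo⇒partialBijection w p coh) =
  π ⟨$⟩ʳ_ , permutation-bijective π , All-zip⇒map same-length sends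
  where
  same-length : length (take (length w ∸ p) w) ≡ length (drop p w)
  same-length = trans (length-take _ w) (trans (m≤n⇒m⊓n≡m (m∸n≤m _ p)) (sym (length-drop p w)))

m+n<o⇒m<o : ∀ {m n o} → m + n < o → m < o
m+n<o⇒m<o {m} = m+n≤o⇒m≤o (suc m)

∸-suc-+ : ∀ {n x p} → x + p < n → n ∸ suc (x + p) + p ≡ n ∸ suc x
∸-suc-+ {n} {x} {p} x+p<n = begin
  n ∸ (suc x + p) + p    ≡⟨ cong (_+ p) (∸-+-assoc n (suc x) p) ⟨
  n ∸ suc x ∸ p + p      ≡⟨ m∸n+n≡m (m+n≤o⇒m≤o∸n p (subst (_≤ n) (+-comm (suc x) p) x+p<n)) ⟩
  n ∸ suc x              ∎
  where open ≡-Reasoning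

∸-suc-< : ∀ {n x} → x < n → n ∸ suc x < n
∸-suc-< x<n = ∸-monoʳ-< (s≤s z≤n) x<n

∸-suc-involutive : ∀ {n t} → t < n → n ∸ suc (n ∸ suc t) ≡ t
∸-suc-involutive {suc n} (s≤s t≤n) = m∸[m∸n]≡n t≤n

+-*-suc : ∀ i t p → i + t * p + p ≡ i + suc t * p
+-*-suc i t p = trans (+-assoc i (t * p) p) (cong (i +_) (+-comm (t * p) p))

+-*-distrib : ∀ i r t p → i + r * p + t * p ≡ i + (r + t) * p
+-*-distrib i r t p = trans (+-assoc i (r * p) (t * p)) (cong (i +_) (sym (*-distribʳ-+ p r t)))

*-suc-≤ : ∀ {t u} p → t < u → t * p + p ≤ u * p
*-suc-≤ {t} {u} p t<u = subst (_≤ u * p) (+-comm p (t * p)) (*-monoˡ-≤ p t<u)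

coherent-sym : ∀ {v : ℕ → A} {p i j} → Coherent v p i j → Coherent v p j i
coherent-sym c = mk⇔ (λ e → sym (to c (sym e))) (λ e → sym (from c (sym e)))

coherent-both : ∀ {v : ℕ → A} {p i j} → v i ≡ v j → v (i + p) ≡ v (j + p) → Coherent v p i j
coherent-both e e′ = mk⇔ (λ _ → e′) (λ _ → e)

coherent-via : ∀ {v : ℕ → A} {p i j k} → v i ≡ v k → Coherent v p i k → Coherent v p k j →
               Coherent v p i j
coherent-via vi≡vk cik ckj = mk⇔
  (λ vi≡vj → trans (to cik vi≡vk) (to ckj (trans (sym vi≡vk) vi≡vj)))
  (λ e → trans vi≡vk (from ckj (trans (sym (to cik vi≡vk)) e)))

coherentUpTo-cong : ∀ {v v′ : ℕ → A} {p n} → (∀ {t} → t < n → v t ≡ v′ t) →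
                    CoherentUpTo v p n → CoherentUpTo v′ p n
coherentUpTo-cong {v = v} {v′} {p} v≗v′ coh {i} {j} hi hj =
  subst₂ (λ a b → a ≡ b ⇔ v′ (i + p) ≡ v′ (j + p)) (v≗v′ (m+n<o⇒m<o hi)) (v≗v′ (m+n<o⇒m<o hj))
    (subst₂ (λ a b → v i ≡ v j ⇔ a ≡ b) (v≗v′ hi) (v≗v′ hj) (coh hi hj))

coherentUpTo-reverse : ∀ {v : ℕ → A} {p n} → CoherentUpTo v p n →
                       CoherentUpTo (λ t → v (n ∸ suc t)) p n
coherentUpTo-reverse {v = v} {p} {n} coh {x} {y} hx hy =
  subst₂ (λ a b → v a ≡ v b ⇔ v (n ∸ suc (x + p)) ≡ v (n ∸ suc (y + p))) (∸-suc-+ hx) (∸-suc-+ hy)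
    (⇔-sym (coh (mirror hx) (mirror hy)))
  where
  mirror : ∀ {t} → t + p < n → n ∸ suc (t + p) + p < n
  mirror h = subst (_< n) (sym (∸-suc-+ h)) (∸-suc-< (m+n<o⇒m<o h))

≤1-∈-≡ : ∀ {L : List A} {x y} → length L ≤ 1 → x ∈ L → y ∈ L → x ≡ y
≤1-∈-≡ {L = _ ∷ []}    _        (here refl) (here refl) = refl
≤1-∈-≡ {L = _ ∷ _ ∷ _} (s≤s ()) _           _

coherentUpTo-≤1 : ∀ {v : ℕ → A} {p n} {L : List A} → length L ≤ 1 → (∀ {t} → t < n → v t ∈ L) →
                  CoherentUpTo v p n
coherentUpTo-≤1 {v = v} |L|≤1 inL hi hj =
  coherent-both {v = v} (≤1-∈-≡ |L|≤1 (inL (m+n<o⇒m<o hi)) (inL (m+n<o⇒m<o hj)))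
                        (≤1-∈-≡ |L|≤1 (inL hi) (inL hj))

pigeonhole-∈ : ∀ {L : List A} {n} → length L < n → (f : Fin n → A) → (∀ t → f t ∈ L) →
               ∃₂ λ t t′ → t Fin.< t′ × f t ≡ f t′
pigeonhole-∈ {L = L} |L|<n f f∈L with t , t′ , t<t′ , same ← Finₚ.pigeonhole |L|<n (index ∘ f∈L) =
  t , t′ , t<t′ , trans (lookup-index (f∈L t)) (trans (cong (lookup L) same) (sym (lookup-index (f∈L t′))))

pigeonhole-apart : ∀ {P : A → Set} {L : List A} {s c d} → length L ≤ 2 + s →
                   c ∈ L → d ∈ L → ¬ P c → ¬ P d →
                   (f : Fin (suc s) → A) → (∀ t → f t ∈ L) → (∀ t → P (f t)) →
                   c ≡ d ⊎ ∃₂ λ t t′ → t Fin.< t′ × f t ≡ f t′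
pigeonhole-apart {P = P} {c = c} {d} |L|≤2+s c∈L d∈L ¬Pc ¬Pd f f∈L Pf
  with pigeonhole-∈ (s≤s |L|≤2+s) (c ∷ᶠ d ∷ᶠ f) (λ { zero → c∈L ; (suc zero) → d∈L ; (suc (suc t)) → f∈L t })
... | zero        , suc zero     , _              , c≡d = inj₁ c≡d
... | zero        , suc (suc t)  , _              , c≡f = contradiction (subst P (sym c≡f) (Pf t)) ¬Pc
... | suc zero    , suc (suc t)  , _              , d≡f = contradiction (subst P (sym d≡f) (Pf t)) ¬Pd
... | suc (suc t) , suc (suc t′) , s≤s (s≤s t<t′) , f≡f = inj₂ (t , t′ , t<t′ , f≡f)
... | _           , zero         , ()             , _
... | suc zero    , suc zero     , s≤s ()         , _
... | suc (suc _) , suc zero     , s≤s ()         , _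

-- Positions [0, a + m) carry xy, with y starting at a; the window is made of the characters at
-- the positions a + k with k + p < m, whose shift by p stays in y.
module Window {A : Set} (v : ℕ → A) {p : ℕ} (p≥1 : 1 ≤ p) (a m : ℕ)
  (back : ∀ {x y} → x + p < a + m → y + p < a + m → v (x + p) ≡ v (y + p) → v x ≡ v y)
  {L : List A} {s : ℕ} (|L|≤2+s : length L ≤ 2 + s) (inL : ∀ {t} → t < a + m → v t ∈ L)
  (long : suc s * p < m) where

  InWindow : A → Set
  InWindow c = ∃ λ k → k + p < m × v (a + k) ≡ c

  Cycle : ℕ → ℕ → Set
  Cycle g ℓ = 1 ≤ ℓ × g + ℓ * p + p < m × v (a + g) ≡ v (a + (g + ℓ * p))

  window-bound : ∀ {k} → k + p < m → a + k < a + m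
  window-bound h = +-monoʳ-< a (m+n<o⇒m<o h)

  cycle-inWindow : ∀ {g ℓ q} → Cycle g ℓ → q ≤ ℓ → InWindow (v (a + (g + q * p)))
  cycle-inWindow {g} (_ , inside , _) q≤ℓ =
    _ , ≤-<-trans (+-monoˡ-≤ p (+-monoʳ-≤ g (*-monoˡ-≤ p q≤ℓ))) inside , refl

  cycle-pred : ∀ {g ℓ q} → Cycle g ℓ → q ≤ ℓ →
               ∃ λ q′ → q′ < ℓ × v (a + (g + q * p)) ≡ v (a + (g + suc q′ * p))
  cycle-pred             {q = suc q} _                 q<ℓ = q , q<ℓ , refl
  cycle-pred {g} {suc ℓ} {zero}      (_ , _ , returns) _   =
    ℓ , ≤-refl , trans (cong (λ h → v (a + h)) (+-identityʳ g)) returns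

  cycle-back : ∀ {g ℓ} → Cycle g ℓ → ∀ t {i q} → q ≤ ℓ → i + t * p < a + m →
               v (i + t * p) ≡ v (a + (g + q * p)) → ∃ λ q′ → q′ ≤ ℓ × v i ≡ v (a + (g + q′ * p))
  cycle-back _ zero {i} q≤ℓ _ e = _ , q≤ℓ , trans (cong v (sym (+-identityʳ i))) e
  cycle-back {g} cyc@(_ , inside , _) (suc t) {i} q≤ℓ i+t<a+m e
    with q′ , q′<ℓ , e′ ← cycle-pred cyc q≤ℓ =
      cycle-back cyc t (<⇒≤ q′<ℓ) (m+n<o⇒m<o i-step)
        (back i-step g-step (trans (cong v (+-*-suc i t p)) (trans e (trans e′ (cong v (sym g-step≡))))))
    where
    i-step : i + t * p + p < a + m
    i-step = subst (_< a + m) (sym (+-*-suc i t p)) i+t<a+m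
    g-step≡ : a + (g + q′ * p) + p ≡ a + (g + suc q′ * p)
    g-step≡ = trans (+-assoc a _ p) (cong (a +_) (+-*-suc g q′ p))
    g-step : a + (g + q′ * p) + p < a + m
    g-step = subst (_< a + m) (sym g-step≡)
      (+-monoʳ-< a (≤-<-trans (+-monoʳ-≤ g (*-monoˡ-≤ p q′<ℓ)) (m+n<o⇒m<o inside)))

  onCycle⇒inWindow : ∀ {g ℓ} → Cycle g ℓ → ∀ t {i} → i + t * p < a + m →
                     v (i + t * p) ≡ v (a + g) → InWindow (v i)
  onCycle⇒inWindow {g} cyc t bound e
    with q′ , q′≤ℓ , e′ ← cycle-back cyc t z≤n bound (trans e (cong (λ h → v (a + h)) (sym (+-identityʳ g))))
    with k , k+p<m , vk ← cycle-inWindow cyc q′≤ℓ = k , k+p<m , trans vk (sym e′)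

  collision⇒cycle : ∀ {g t t′} → t < t′ → g + t′ * p + p < m →
                    v (a + (g + t * p)) ≡ v (a + (g + t′ * p)) → ∃ (Cycle (g + t * p))
  collision⇒cycle {g} {t} t<t′ inside e with o , refl ← m≤n⇒∃[o]m+o≡n t<t′ =
    suc o , s≤s z≤n , subst (λ h → h + p < m) (sym split) inside ,
    trans e (cong (λ h → v (a + h)) (sym split))
    where
    split : g + t * p + suc o * p ≡ g + (suc t + o) * p
    split = trans (+-*-distrib g t (suc o) p) (cong (λ r → g + r * p) (+-suc t o))

  enter : ∀ {i} → i < a → ∃₂ λ r ρ → ρ < p × i + r * p ≡ a + ρ
  enter {i} i<a = go a (m≤n+m a i) (<-≤-trans i<a (m≤m+n a p))
    where
    slide : ∀ i fuel → i + suc fuel ≤ i + p + fuel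
    slide i fuel = subst (_≤ i + p + fuel) (+-assoc i 1 fuel) (+-monoˡ-≤ fuel (+-monoʳ-≤ i p≥1))
    go : ∀ fuel {i} → a ≤ i + fuel → i < a + p → ∃₂ λ r ρ → ρ < p × i + r * p ≡ a + ρ
    go fuel {i} a≤ i< with a ≤? i
    ... | yes a≤i with ρ , refl ← m≤n⇒∃[o]m+o≡n a≤i = 0 , ρ , +-cancelˡ-< a _ _ i< , +-identityʳ _
    go zero       {i} a≤ _ | no a≰i = contradiction (subst (a ≤_) (+-identityʳ i) a≤) a≰i
    go (suc fuel) {i} a≤ _ | no a≰i
      with r , ρ , ρ<p , e ← go fuel (≤-trans a≤ (slide i fuel)) (+-monoˡ-< p (≰⇒> a≰i)) =
        suc r , ρ , ρ<p , trans (sym (+-assoc i p (r * p))) e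

  progression : Fin (suc s) → A
  progression t = v (a + toℕ t * p)

  progression-inside : ∀ (t : Fin (suc s)) → toℕ t * p + p < m
  progression-inside t = ≤-<-trans (*-suc-≤ p (Finₚ.toℕ<n t)) long

  outsiders-equal-or-cycle : ∀ {c d} → c ∈ L → d ∈ L → ¬ InWindow c → ¬ InWindow d →
                             c ≡ d ⊎ ∃₂ Cycle
  outsiders-equal-or-cycle c∈L d∈L c∉ d∉ =
    Sum.map₂ cycle (pigeonhole-apart {P = InWindow} |L|≤2+s c∈L d∈L c∉ d∉ progression
      (λ t → inL (window-bound {toℕ t * p} (progression-inside t))) (λ t → _ , progression-inside t , refl))
    where
    cycle : (∃₂ λ t t′ → t Fin.< t′ × progression t ≡ progression t′) → ∃₂ Cycle
    cycle (t , t′ , t<t′ , e) = _ , collision⇒cycle {g = 0} t<t′ (progression-inside t′) e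

  outsider-equal : ∀ {g ℓ i d} → Cycle g ℓ → i < a → ¬ InWindow (v i) → d ∈ L → ¬ InWindow d → v i ≡ d
  outsider-equal {g} {i = i} cyc@(_ , inside , _) i<a vi∉ d∈L d∉ with r , ρ , ρ<p , entry ← enter i<a =
    [ id , ⊥-elim ∘ collision ]′
      (pigeonhole-apart {P = InWindow} |L|≤2+s (inL (<-≤-trans i<a (m≤m+n a m))) d∈L vi∉ d∉
                        sequence sequence∈L sequence-inWindow)
    where
    orbit-inside : ∀ {τ} → τ < s → ρ + τ * p + p < m
    orbit-inside {τ} τ<s =
      <-trans (<-≤-trans (+-monoˡ-< p (+-monoˡ-< (τ * p) ρ<p)) (*-suc-≤ p (s≤s τ<s))) long
    sequence : Fin (suc s) → A
    sequence zero    = v (a + g)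
    sequence (suc τ) = v (a + (ρ + toℕ τ * p))
    sequence-inWindow : ∀ t → InWindow (sequence t)
    sequence-inWindow zero    = g , ≤-<-trans (+-monoˡ-≤ p (m≤m+n g _)) inside , refl
    sequence-inWindow (suc τ) = _ , orbit-inside (Finₚ.toℕ<n τ) , refl
    sequence∈L : ∀ t → sequence t ∈ L
    sequence∈L t with k , k+p<m , e ← sequence-inWindow t = subst (_∈ L) e (inL (window-bound k+p<m))
    reach : ∀ τ → i + (r + τ) * p ≡ a + (ρ + τ * p)
    reach τ = trans (sym (+-*-distrib i r τ p)) (trans (cong (_+ τ * p) entry) (+-assoc a ρ (τ * p)))
    orbit-off-cycles : ∀ {g′ ℓ′ τ} → Cycle g′ ℓ′ → τ < s → v (a + (ρ + τ * p)) ≡ v (a + g′) → ⊥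
    orbit-off-cycles {τ = τ} cyc′ τ<s e =
      vi∉ (onCycle⇒inWindow cyc′ (r + τ) (subst (_< a + m) (sym (reach τ)) (window-bound (orbit-inside τ<s)))
                                          (trans (cong v (reach τ)) e))
    collision : (∃₂ λ t t′ → t Fin.< t′ × sequence t ≡ sequence t′) → ⊥
    collision (zero  , suc τ′ , _ , e) = orbit-off-cycles cyc (Finₚ.toℕ<n τ′) (sym e)
    collision (suc τ , suc τ′ , s≤s τ<τ′ , e)
      with _ , cyc′ ← collision⇒cycle τ<τ′ (orbit-inside (Finₚ.toℕ<n τ′)) e =
        orbit-off-cycles cyc′ (Finₚ.toℕ<n τ) refl

  outsider-unique : ∀ {i d} → i < a → ¬ InWindow (v i) → d ∈ L → ¬ InWindow d → v i ≡ d
  outsider-unique i<a vi∉ d∈L d∉ =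
    [ id , (λ (_ , _ , cyc) → outsider-equal cyc i<a vi∉ d∈L d∉) ]′
      (outsiders-equal-or-cycle (inL (<-≤-trans i<a (m≤m+n a m))) d∈L vi∉ d∉)

module Join {A : Set} (_≟_ : DecidableEquality A) (v : ℕ → A) {p : ℕ} (p≥1 : 1 ≤ p) (a m z : ℕ)
  {L : List A} {s : ℕ} (|L|≤2+s : length L ≤ 2 + s) (long : suc s * p < m)
  (inL : ∀ {t} → t < a + (m + z) → v t ∈ L)
  (left : CoherentUpTo v p (a + m)) (right : CoherentUpTo (λ t → v (a + t)) p (m + z)) where

  v₂ : ℕ → A
  v₂ t = v (a + t)

  -- y z read backwards, so that z plays the role of x in the window argument
  v₂-reversed : ℕ → A
  v₂-reversed t = v₂ (z + m ∸ suc t)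

  p<m : p < m
  p<m = <-≤-trans (s≤s (m≤m+n p (s * p))) long

  inL-left : ∀ {t} → t < a + m → v t ∈ L
  inL-left t< = inL (<-≤-trans t< (+-monoʳ-≤ a (m≤m+n m z)))

  module Left = Window v p≥1 a m (λ hx hy → from (left hx hy)) |L|≤2+s inL-left long

  module Right = Window v₂-reversed p≥1 z m
                   (λ hx hy → from (coherentUpTo-reverse (subst (CoherentUpTo v₂ p) (+-comm m z) right) hx hy))
                   |L|≤2+s (λ {t} t< → inL (+-monoʳ-< a (subst (z + m ∸ suc t <_) (+-comm z m) (∸-suc-< t<))))
                   long

  inLeftWindow? : ∀ c → Dec (Left.InWindow c)
  inLeftWindow? c = map′ (λ (k , _ , h) → k , h) (λ (k , h) → k , m+n<o⇒m<o (proj₁ h) , h)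
                         (anyUpTo? (λ k → (k + p <? m) ×-dec (v (a + k) ≟ c)) m)

  rightWindow⇒shiftedWindow : ∀ {c} → Right.InWindow c → ∃ λ k → k + p < m × v₂ (k + p) ≡ c
  rightWindow⇒shiftedWindow (k , k+p<m , e) =
    m ∸ suc (k + p) , subst (_< m) (sym (∸-suc-+ k+p<m)) (∸-suc-< (m+n<o⇒m<o k+p<m)) ,
    trans (cong v₂ mirrored) e
    where
    mirrored : m ∸ suc (k + p) + p ≡ z + m ∸ suc (z + k)
    mirrored = trans (∸-suc-+ k+p<m) (trans (sym ([m+n]∸[m+o]≡n∸o z m (suc k))) (cong (z + m ∸_) (+-suc z k)))

  right-offset : ∀ {I J} → I + p < m + z → J + p < m + z → Coherent v p (a + I) (a + J)
  right-offset {I} {J} hI hJ =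
    subst₂ (λ x y → v (a + I) ≡ v (a + J) ⇔ v x ≡ v y) (sym (+-assoc a I p)) (sym (+-assoc a J p))
           (right hI hJ)

  left-inside : ∀ {k} → k + p < m → a + k + p < a + m
  left-inside {k} h = subst (_< a + m) (sym (+-assoc a k p)) (+-monoʳ-< a h)

  left-outside : ∀ {i} → i < a → i + p < a + m
  left-outside i<a = +-mono-< i<a p<m

  right-inside : ∀ {k} → k + p < m → k + p < m + z
  right-inside h = <-≤-trans h (m≤m+n _ z)

  mixed : ∀ {i J} → i < a → m ≤ J + p → J + p < m + z → Coherent v p i (a + J)
  mixed {i} {J} i<a m≤J+p J+p<m+z with inLeftWindow? (v i) | inLeftWindow? (v (a + J))
  ... | yes (k , k+p<m , vk≡vi) | _ =
    coherent-via {v = v} (sym vk≡vi) (left (left-outside i<a) (left-inside k+p<m))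
                                     (right-offset (right-inside k+p<m) J+p<m+z)
  ... | no _ | yes (k , k+p<m , vk≡vj) =
    coherent-sym {v = v} (coherent-via {v = v} (sym vk≡vj) (right-offset J+p<m+z (right-inside k+p<m))
                                                           (left (left-inside k+p<m) (left-outside i<a)))
  ... | no vi∉ | no vj∉ = coherent-both {v = v}
    (Left.outsider-unique i<a vi∉ (inL (+-monoʳ-< a (m+n<o⇒m<o J+p<m+z))) vj∉)
    (trans (sym (Right.outsider-unique j′<z vj∉′ (inL-left (left-outside i<a)) vi∉′))
           (trans reflected (cong v (sym (+-assoc a J p)))))
    where
    j′ : ℕ
    j′ = z + m ∸ suc (J + p)
    J+p<z+m : J + p < z + m
    J+p<z+m = subst (J + p <_) (+-comm m z) J+p<m+z
    j′<z : j′ < z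
    j′<z = subst (j′ <_) (m+n∸n≡m z m) (∸-monoʳ-< (s≤s m≤J+p) J+p<z+m)
    reflected : v₂-reversed j′ ≡ v₂ (J + p)
    reflected = cong v₂ (∸-suc-involutive J+p<z+m)
    vj∉′ : ¬ Right.InWindow (v₂-reversed j′)
    vj∉′ w with k , k+p<m , e ← rightWindow⇒shiftedWindow w =
      vj∉ (k , k+p<m , from (right (right-inside k+p<m) J+p<m+z) (trans e reflected))
    vi∉′ : ¬ Right.InWindow (v (i + p))
    vi∉′ w with k , k+p<m , e ← rightWindow⇒shiftedWindow w =
      vi∉ (k , k+p<m , from (left (left-inside k+p<m) (left-outside i<a)) (trans (cong v (+-assoc a k p)) e))

  beyond-left : ∀ {t} → ¬ t + p < a + m → a ≤ t
  beyond-left {t} h = +-cancelʳ-≤ p a t (≤-trans (+-monoʳ-≤ a (<⇒≤ p<m)) (≮⇒≥ h))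

  within-right : ∀ {I} → a + I + p < a + (m + z) → I + p < m + z
  within-right {I} h = +-cancelˡ-< a _ _ (subst (_< a + (m + z)) (+-assoc a I p) h)

  right-coherent : ∀ {i j} → a ≤ i → a ≤ j → i + p < a + (m + z) → j + p < a + (m + z) → Coherent v p i j
  right-coherent a≤i a≤j hi hj with I , refl ← m≤n⇒∃[o]m+o≡n a≤i | J , refl ← m≤n⇒∃[o]m+o≡n a≤j =
    right-offset (within-right hi) (within-right hj)

  mixed′ : ∀ {i j} → i < a → ¬ j + p < a + m → j + p < a + (m + z) → Coherent v p i j
  mixed′ i<a hj hj′ with J , refl ← m≤n⇒∃[o]m+o≡n (beyond-left hj) =
    mixed i<a (+-cancelˡ-≤ a _ _ (subst (a + m ≤_) (+-assoc a J p) (≮⇒≥ hj))) (within-right hj′)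

  coherent : CoherentUpTo v p (a + (m + z))
  coherent {i} {j} hi hj with i + p <? a + m | j + p <? a + m
  ... | yes hi′ | yes hj′ = left hi′ hj′
  ... | no  hi′ | no  hj′ = right-coherent (beyond-left hi′) (beyond-left hj′) hi hj
  ... | yes _   | no  hj′ with a ≤? i
  ...   | yes a≤i = right-coherent a≤i (beyond-left hj′) hi hj
  ...   | no  a≰i = mixed′ (≰⇒> a≰i) hj′ hj
  coherent {i} {j} hi hj | no hi′ | yes _ with a ≤? j
  ...   | yes a≤j = right-coherent (beyond-left hi′) a≤j hi hj
  ...   | no  a≰j = coherent-sym {v = v} (mixed′ (≰⇒> a≰j) hi′ hi)

coherentUpTo-join : ∀ {A : Set} → DecidableEquality A → ∀ {v : ℕ → A} {p a m z} {L : List A} → 1 ≤ p →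
                    p * (length L ∸ 1) < m → (∀ {t} → t < a + (m + z) → v t ∈ L) →
                    CoherentUpTo v p (a + m) → CoherentUpTo (λ t → v (a + t)) p (m + z) →
                    CoherentUpTo v p (a + (m + z))
coherentUpTo-join _≟_ {v} {p} {a} {m} {z} {L} p≥1 long inL left right with length L in |L|≡
... | zero        = coherentUpTo-≤1 (≤-trans (≤-reflexive |L|≡) z≤n) inL
... | suc zero    = coherentUpTo-≤1 (≤-reflexive |L|≡) inL
... | suc (suc s) =
  Join.coherent _≟_ v p≥1 a m z (≤-reflexive |L|≡) (subst (_< m) (*-comm p (suc s)) long) inL left right

period⇒coherentUpTo-prefix : ∀ {k} (u v : Str k) p → IsPPeriod u p → CoherentUpTo (at (u ++ v)) p (length u)
period⇒coherentUpTo-prefix u v p period =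
  coherentUpTo-cong (λ t< → sym (at-++ˡ u t<)) (period⇒coherentUpTo u p period)

period⇒coherentUpTo-suffix : ∀ {k} (u v : Str k) p → IsPPeriod v p →
                             CoherentUpTo (λ t → at (u ++ v) (length u + t)) p (length v)
period⇒coherentUpTo-suffix u v p period =
  coherentUpTo-cong (λ {t} _ → sym (at-++ʳ u t)) (period⇒coherentUpTo v p period)

Chars : ∀ {k} → Str k → List (Maybe (Fin k))
Chars s = map just (deduplicate Finₚ._≟_ s)

length-Chars : ∀ {k} (s : Str k) → length (Chars s) ≡ numChars s
length-Chars s = length-map just (deduplicate Finₚ._≟_ s)

at∈Chars : ∀ {k} {w s : Str k} {t} → IsSubstring w s → t < length w → at w t ∈ Chars s
at∈Chars {w = w} (u , u′ , refl) t< with c , e , c∈w ← <⇒at-just w t< =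
  subst (_∈ _) (sym e) (∈-map⁺ just (∈-deduplicate⁺ Finₚ._≟_ (∈-++⁺ʳ u (∈-++⁺ˡ c∈w))))

lemma12 : (k : ℕ) (x y z s : List (Fin k)) (p : ℕ) →
          1 ≤ length x → 1 ≤ length y → 1 ≤ length z →
          IsSubstring (x ++ y ++ z) s →
          1 ≤ p →
          IsPPeriod (x ++ y) p →
          IsPPeriod (y ++ z) p →
          p * (numChars s ∸ 1) + 1 ≤ length y →
          IsPPeriod (x ++ y ++ z) p
lemma12 k x y z s p _ _ _ xyz⊆s p≥1 xy-period yz-period long =
  coherentUpTo⇒period w p (subst (CoherentUpTo (at w) p) (sym |w|)
    (coherentUpTo-join (≡-dec Finₚ._≟_) p≥1 long′ (at∈Chars xyz⊆s ∘ subst (_ <_) (sym |w|)) left right))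
  where
  w = x ++ y ++ z
  |w| : length w ≡ length x + (length y + length z)
  |w| = trans (length-++ x) (cong (length x +_) (length-++ y))
  long′ : p * (length (Chars s) ∸ 1) < length y
  long′ = subst (λ σ → p * (σ ∸ 1) < length y) (sym (length-Chars s)) (subst (_≤ length y) (+-comm _ 1) long)
  left : CoherentUpTo (at w) p (length x + length y)
  left = subst₂ (λ u n → CoherentUpTo (at u) p n) (++-assoc x y z) (length-++ x)
           (period⇒coherentUpTo-prefix (x ++ y) z p xy-period)
  right : CoherentUpTo (λ t → at w (length x + t)) p (length y + length z)
  right = subst (CoherentUpTo (λ t → at w (length x + t)) p) (length-++ y)
            (period⇒coherentUpTo-suffix x (y ++ z) p yz-period)
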